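{- For every forest $F=(V,E)$ we have $\text{ffn}(F)\le \log_3(2|V|+1)+2$.
   Context: All graphs are finite, simple and undirected. For a graph $G=(V,E)$ and $W\subseteq V$, $N(W)$ is the set of nodes in $V\setminus W$ adjacent to at least one node of $W$. For $m\in\mathbb{N}_{>0}$, an $m$-strategy of length $T$ is a sequence $(F_1,\dots,F_T)$ of subsets of $V$ with $|F_i|\le m$. Its burning sets are $B_0=V$ and $B_t=(B_{t-1}\setminus F_t)\cup N(B_{t-1}\setminus F_t)$ for $t\ge1$, where $F_t=\emptyset$ for $t>T$. The strategy is winning if $B_T=\emptyset$. The firefighter number $\text{ffn}(G)$ is the smallest $m$ for which a winning $m$-strategy for $G$ exists. -}

module Defs where

open import Data.Nat using (ℕ; suc; _≤_; _<_)
open import Data.Bool using (Bool; true; false; not; _∧_)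
open import Data.Fin using (Fin)
open import Data.Fin.Subset using (Subset; ⊤; ⊥; _∪_; _─_; ∣_∣)
open import Data.Vec using (Vec; tabulate; lookup)
open import Data.List using (List; []; _∷_; _++_; allFin; foldl)
open import Data.Bool.ListAction using (any)
open import Data.List.Relation.Unary.All using (All)
open import Data.List.Relation.Unary.Unique.Propositional using (Unique)
open import Data.Product using (Σ; _×_; ∃)
open import Relation.Binary.PropositionalEquality using (_≡_)
open import Relation.Nullary using (¬_)

record Graph (n : ℕ) : Set where
  field
    adj       : Fin n → Fin n → Bool
    symmetric : ∀ u v → adj u v ≡ adj v u
    irrefl    : ∀ v → adj v v ≡ false
open Graph public

Adj : ∀ {n} → Graph n → Fin n → Fin n → Set
Adj G u v = adj G u v ≡ true

data Path {n} (G : Graph n) : List (Fin n) → Set where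
  []  : Path G []
  [_] : ∀ v → Path G (v ∷ [])
  _∷_ : ∀ {u v vs} → Adj G u v → Path G (v ∷ vs) → Path G (u ∷ v ∷ vs)

-- A cycle: distinct vertices v₀, v₁, …, v_k with k ≥ 2 (at least 3 vertices),
-- v_i adjacent to v_{i+1}, and v_k adjacent to v₀.
record Cycle {n} (G : Graph n) : Set where
  field
    v₀ v₁ : Fin n
    rest  : List (Fin n)
    last  : Fin n
    distinct : Unique (v₀ ∷ v₁ ∷ rest ++ (last ∷ []))
    path     : Path G (v₀ ∷ v₁ ∷ rest ++ (last ∷ []))
    closing  : Adj G last v₀

IsForest : ∀ {n} → Graph n → Set
IsForest G = ¬ Cycle G

N : ∀ {n} → Graph n → Subset n → Subset n
N {n} G W = tabulate λ v → not (lookup W v) ∧ any (λ u → lookup W u ∧ adj G u v) (allFin n)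

step : ∀ {n} → Graph n → Subset n → Subset n → Subset n
step G B F = (B ─ F) ∪ N G (B ─ F)

burningAfter : ∀ {n} → Graph n → List (Subset n) → Subset n
burningAfter G S = foldl (step G) ⊤ S

IsStrategy : ∀ {n} → ℕ → List (Subset n) → Set
IsStrategy m S = All (λ F → ∣ F ∣ ≤ m) S

WinningStrategy : ∀ {n} → Graph n → ℕ → Set
WinningStrategy {n} G m = Σ (List (Subset n)) λ S → IsStrategy m S × burningAfter G S ≡ ⊥

IsFfn : ∀ {n} → Graph n → ℕ → Set
IsFfn G m = 0 < m × WinningStrategy G m × (∀ k → 0 < k → k < m → ¬ WinningStrategy G k)

module Submission where

-- By induction on j, j + 1 firefighters per round clear every vertex set of the forest whose
-- components T all satisfy 2|T| + 1 < 3^j; the components are cleared one after another.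
-- In a tree T with 2|T| + 1 < 3^(j+1), call v a spine vertex if for every other vertex x the
-- branch of T − x containing v has at least |T|/3 vertices. A spine vertex has at most two
-- spine neighbours (three such branches do not fit into T − v), and every piece of T off the
-- spine lies in a branch with fewer than |T|/3 vertices, so the induction hypothesis clears it.
-- Sweep the spine from an end p: clear the pieces hanging at p with j + 1 firefighters while one
-- more defends p, then defend p and its successor on the spine for one round, which puts p out.
-- Hence j + 2 firefighters clear T, and ffn(F) ≤ j + 1 as soon as 2|V| + 1 < 3^j.

open import Defs
open import Data.Nat using (ℕ; _≤_; _^_; _∸_; _+_; _*_)

open import Data.Bool using (Bool; true; false; not; _∧_)
open import Data.Bool.ListAction using (any)
open import Data.Bool.Properties using (T-≡; T-∧; ¬-not) renaming (_≟_ to _≟ᵇ_)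
open import Data.Empty using (⊥)
open import Data.Fin using (Fin)
open import Data.Fin.Properties using (_≟_; any?; all?)
open import Data.Fin.Subset
  using (Subset; inside; outside; _∈_; _∉_; _⊆_; _⊂_; ⊤; ⁅_⁆; _∩_; _∪_; _─_; _-_; ∣_∣)
  renaming (⊥ to ∅)
open import Data.Fin.Subset.Properties
open import Data.List using (List; []; _∷_; _∷ʳ_; foldl; filter; allFin; last; initLast; _∷ʳ′_)
import Data.List.Membership.DecPropositional as DecMembership
import Data.List.Membership.Propositional as List
open import Data.List.Membership.Propositional.Properties using (∈-filter⁺; ∈-filter⁻; ∈-allFin)
open import Data.List.Relation.Unary.All as All using (All; []; _∷_)
open import Data.List.Relation.Unary.All.Properties using (¬Any⇒All¬)
open import Data.List.Relation.Unary.AllPairs using ([]; _∷_)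
open import Data.List.Relation.Unary.Any using (satisfied; here; there)
open import Data.List.Relation.Unary.Any.Properties using (any⁺; any⁻)
open import Data.List.Relation.Unary.Unique.Propositional using (Unique)
open import Data.Maybe using (just)
open import Data.Maybe.Properties using (just-injective)
open import Data.Nat using (zero; suc; _<_; z≤n; s≤s; _≤?_; _<?_; _≤′_; ≤′-refl; ≤′-step)
open import Data.Nat.Properties hiding (_≟_)
import Data.List.Extrema ≤-totalOrder as Extrema
open import Data.Nat.Tactic.RingSolver using (solve-∀)
open import Data.Product using (∃; Σ-syntax; ∃-syntax; _×_; _,_; proj₁; proj₂)
open import Data.Sum using (_⊎_; inj₁; inj₂; [_,_]′)
open import Data.Vec using ([]; _∷_; lookup; tabulate; here; there)
open import Data.Vec.Properties using (lookup∘tabulate; []=⇒lookup; lookup⇒[]=)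
open import Function using (_∘_)
open import Function.Bundles using (Equivalence)
open import Relation.Binary.PropositionalEquality
open import Relation.Nullary using (Dec; yes; no; does; contradiction)
open import Relation.Nullary.Decidable using (dec-true; decidable-stable; _×-dec_; _→-dec_; ¬?)

private
  variable
    n : ℕ

module _ {n : ℕ} where

  ∈-tabulate⁺ : ∀ {f : Fin n → Bool} {x} → f x ≡ true → x ∈ tabulate f
  ∈-tabulate⁺ {f} {x} fx = lookup⇒[]= x _ (trans (lookup∘tabulate f x) fx)

  ∈-tabulate⁻ : ∀ {f : Fin n → Bool} {x} → x ∈ tabulate f → f x ≡ true
  ∈-tabulate⁻ {f} {x} x∈ = trans (sym (lookup∘tabulate f x)) ([]=⇒lookup x∈)

  select : {P : Fin n → Set} → (∀ v → Dec (P v)) → Subset n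
  select P? = tabulate (does ∘ P?)

  module _ {P : Fin n → Set} (P? : ∀ v → Dec (P v)) where

    ∈-select⁺ : ∀ {x} → P x → x ∈ select P?
    ∈-select⁺ {x} px = ∈-tabulate⁺ (dec-true (P? x) px)

    ∈-select⁻ : ∀ {x} → x ∈ select P? → P x
    ∈-select⁻ {x} x∈ with P? x | ∈-tabulate⁻ {does ∘ P?} x∈
    ... | yes px | _ = px

x∈p─q⇒x∉q : ∀ {p q : Subset n} {x} → x ∈ p ─ q → x ∉ q
x∈p─q⇒x∉q {p = inside ∷ p} {outside ∷ q} here ()
x∈p─q⇒x∉q {p = _ ∷ p}      {_ ∷ q}       (there x∈) (there x∈q) = x∈p─q⇒x∉q x∈ x∈q

x∈p-y⇒x≢y : ∀ {p : Subset n} {x y} → x ∈ p - y → x ≢ y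
x∈p-y⇒x≢y x∈ refl = x∈p─q⇒x∉q x∈ (x∈⁅x⁆ _)

x∉p-x : ∀ {p : Subset n} {x} → x ∉ p - x
x∉p-x x∈ = x∈p-y⇒x≢y x∈ refl

p⊆q⇒p─r⊆q─r : ∀ {p q r : Subset n} → p ⊆ q → p ─ r ⊆ q ─ r
p⊆q⇒p─r⊆q─r {p = p} {r = r} p⊆q x∈ = x∈p∧x∉q⇒x∈p─q (p⊆q (p─q⊆p p r x∈)) (x∈p─q⇒x∉q x∈)

p⊆q⇒p∪r⊆q∪r : ∀ {p q r : Subset n} → p ⊆ q → p ∪ r ⊆ q ∪ r
p⊆q⇒p∪r⊆q∪r {p = p} {r = r} p⊆q x∈ with x∈p∪q⁻ p r x∈
... | inj₁ x∈p = x∈p∪q⁺ (inj₁ (p⊆q x∈p))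
... | inj₂ x∈r = x∈p∪q⁺ (inj₂ x∈r)

p⊆q⇒p∩r⊆q∩r : ∀ {p q r : Subset n} → p ⊆ q → p ∩ r ⊆ q ∩ r
p⊆q⇒p∩r⊆q∩r {p = p} {r = r} p⊆q x∈ with x∈p , x∈r ← x∈p∩q⁻ p r x∈ = x∈p∩q⁺ (p⊆q x∈p , x∈r)

∣p∪q∣≤∣p∣+∣q∣ : ∀ (p q : Subset n) → ∣ p ∪ q ∣ ≤ ∣ p ∣ + ∣ q ∣
∣p∪q∣≤∣p∣+∣q∣ []            []            = z≤n
∣p∪q∣≤∣p∣+∣q∣ (inside  ∷ p) (s ∷ q)       =
  s≤s (≤-trans (∣p∪q∣≤∣p∣+∣q∣ p q) (+-monoʳ-≤ ∣ p ∣ (∣p∣≤∣x∷p∣ s q)))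
∣p∪q∣≤∣p∣+∣q∣ (outside ∷ p) (inside  ∷ q) =
  ≤-trans (s≤s (∣p∪q∣≤∣p∣+∣q∣ p q)) (≤-reflexive (sym (+-suc ∣ p ∣ ∣ q ∣)))
∣p∪q∣≤∣p∣+∣q∣ (outside ∷ p) (outside ∷ q) = ∣p∪q∣≤∣p∣+∣q∣ p q

∣p∪q∣≡∣p∣+∣q∣ : ∀ (p q : Subset n) → (∀ {x} → x ∈ p → x ∉ q) → ∣ p ∪ q ∣ ≡ ∣ p ∣ + ∣ q ∣
∣p∪q∣≡∣p∣+∣q∣ []            []            _    = refl
∣p∪q∣≡∣p∣+∣q∣ (inside  ∷ p) (inside  ∷ q) disj = contradiction here (disj here)
∣p∪q∣≡∣p∣+∣q∣ (inside  ∷ p) (outside ∷ q) disj =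
  cong suc (∣p∪q∣≡∣p∣+∣q∣ p q λ x∈p x∈q → disj (there x∈p) (there x∈q))
∣p∪q∣≡∣p∣+∣q∣ (outside ∷ p) (inside  ∷ q) disj =
  trans (cong suc (∣p∪q∣≡∣p∣+∣q∣ p q λ x∈p x∈q → disj (there x∈p) (there x∈q)))
        (sym (+-suc ∣ p ∣ ∣ q ∣))
∣p∪q∣≡∣p∣+∣q∣ (outside ∷ p) (outside ∷ q) disj =
  ∣p∪q∣≡∣p∣+∣q∣ p q λ x∈p x∈q → disj (there x∈p) (there x∈q)

argmax-in : ∀ (p : Subset n) (f : Fin n → ℕ) {x₀} → x₀ ∈ p →
            Σ[ x ∈ Fin n ] x ∈ p × (∀ {y} → y ∈ p → f y ≤ f x)
argmax-in {n} p f {x₀} x₀∈p =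
  Extrema.argmax f x₀ candidates ,
  Extrema.argmax-all f {xs = candidates} x₀∈p
    (All.tabulate (proj₂ ∘ ∈-filter⁻ (_∈? p) {xs = allFin n})) ,
  λ y∈p → All.lookup (Extrema.f[xs]≤f[argmax] {f = f} x₀ candidates)
                     (∈-filter⁺ (_∈? p) (∈-allFin _) y∈p)
  where
  candidates = filter (_∈? p) (allFin n)

-- Connected components

module _ {n : ℕ} (G : Graph n) where

  private
    variable
      u v w x y : Fin n
      W Z Z′ : Subset n

  Adj-sym : Adj G u v → Adj G v u
  Adj-sym {u} {v} uv = trans (symmetric G v u) uv

  Adj⇒≢ : Adj G u v → u ≢ v
  Adj⇒≢ {u} uu refl = contradiction (trans (sym uu) (irrefl G u)) λ ()

  ∈N⁻ : v ∈ N G W → v ∉ W × ∃[ u ] u ∈ W × Adj G u v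
  ∈N⁻ {v} {W} v∈N with lookup W v in v∉W | ∈-tabulate⁻ v∈N
  ... | false | some-edge with satisfied (any⁻ _ (allFin n) (Equivalence.from T-≡ some-edge))
  ... | u , edge with u∈W , uv ← Equivalence.to T-∧ edge =
    (λ v∈W → contradiction (trans (sym ([]=⇒lookup v∈W)) v∉W) λ ()) ,
    u , lookup⇒[]= u W (Equivalence.to T-≡ u∈W) , Equivalence.to T-≡ uv

  ∈N⁺ : v ∉ W → u ∈ W → Adj G u v → v ∈ N G W
  ∈N⁺ {v} {W} {u} v∉W u∈W uv = ∈-tabulate⁺ (begin
    not (lookup W v) ∧ any edge (allFin n)  ≡⟨ cong (λ b → not b ∧ any edge (allFin n)) v∉W′ ⟩
    any edge (allFin n)                     ≡⟨ Equivalence.to T-≡ (any⁺ edge some-edge) ⟩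
    true                                    ∎)
    where
    open ≡-Reasoning
    edge = λ u → lookup W u ∧ adj G u v
    v∉W′ = ¬-not (v∉W ∘ lookup⇒[]= v W)
    some-edge = List.lose (∈-allFin u)
      (Equivalence.from T-∧ (Equivalence.from T-≡ ([]=⇒lookup u∈W) , Equivalence.from T-≡ uv))

  ball : Subset n → Fin n → ℕ → Subset n
  ball Z x zero    = ⁅ x ⁆ ∩ Z
  ball Z x (suc t) = ball Z x t ∪ (Z ∩ N G (ball Z x t))

  component : Subset n → Fin n → Subset n
  component Z x = ball Z x n

  ball-mono : ∀ {t t′} → t ≤ t′ → ball Z x t ⊆ ball Z x t′
  ball-mono = go ∘ ≤⇒≤′
    where
    go : ∀ {t t′} → t ≤′ t′ → ball Z x t ⊆ ball Z x t′
    go ≤′-refl        y∈ = y∈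
    go (≤′-step t≤t′) y∈ = p⊆p∪q _ (go t≤t′ y∈)

  Stable : Subset n → Fin n → ℕ → Set
  Stable Z x t = ball Z x (suc t) ⊆ ball Z x t

  stable-suc : ∀ {t} → Stable Z x t → Stable Z x (suc t)
  stable-suc stable y∈ with x∈p∪q⁻ _ _ y∈
  ... | inj₁ y∈ball = y∈ball
  ... | inj₂ y∈new with y∈Z , y∈N ← x∈p∩q⁻ _ _ y∈new with y∉ball , u , u∈ball , uy ← ∈N⁻ y∈N =
    x∈p∪q⁺ (inj₂ (x∈p∩q⁺ (y∈Z , ∈N⁺ (y∉ball ∘ p⊆p∪q _) (stable u∈ball) uy)))

  stable-or-grows : ∀ t → Stable Z x t ⊎ ∣ ball Z x t ∣ < ∣ ball Z x (suc t) ∣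
  stable-or-grows {Z} {x} t with ball Z x t ⊂? ball Z x (suc t)
  ... | yes ball⊂ = inj₂ (p⊂q⇒∣p∣<∣q∣ ball⊂)
  ... | no ¬ball⊂ = inj₁ λ {y} y∈ →
    decidable-stable (y ∈? ball Z x t) λ y∉ → ¬ball⊂ (p⊆p∪q _ , y , y∈ , y∉)

  stable-or-large : ∀ t → Stable Z x t ⊎ t < ∣ ball Z x (suc t) ∣
  stable-or-large zero with stable-or-grows zero
  ... | inj₁ stable = inj₁ stable
  ... | inj₂ grows  = inj₂ (≤-<-trans z≤n grows)
  stable-or-large (suc t) with stable-or-large t | stable-or-grows (suc t)
  ... | inj₁ stable | _           = inj₁ (stable-suc {t = t} stable)
  ... | inj₂ _      | inj₁ stable = inj₁ stable
  ... | inj₂ large  | inj₂ grows  = inj₂ (≤-<-trans large grows)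

  component-stable : Stable Z x n
  component-stable {Z} {x} with stable-or-large {Z} {x} n
  ... | inj₁ stable = stable
  ... | inj₂ large  = contradiction (∣p∣≤n (ball Z x (suc n))) (<⇒≱ large)

  component-closed : u ∈ component Z x → v ∈ Z → Adj G u v → v ∈ component Z x
  component-closed {Z = Z} {x} {v} u∈ v∈Z uv with v ∈? component Z x
  ... | yes v∈ = v∈
  ... | no v∉  = component-stable (x∈p∪q⁺ (inj₂ (x∈p∩q⁺ (v∈Z , ∈N⁺ v∉ u∈ uv))))

  component-ind : (P : Fin n → Set) → (x ∈ Z → P x) →
                  (∀ {u v} → u ∈ component Z x → P u → v ∈ Z → Adj G u v → P v) →
                  ∀ {y} → y ∈ component Z x → P y
  component-ind {x} {Z} P base step = go n ≤-refl
    where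
    go : ∀ t → t ≤ n → ∀ {y} → y ∈ ball Z x t → P y
    go zero _ y∈ with y∈⁅x⁆ , y∈Z ← x∈p∩q⁻ _ _ y∈ with refl ← x∈⁅y⁆⇒x≡y _ y∈⁅x⁆ = base y∈Z
    go (suc t) t<n y∈ with x∈p∪q⁻ _ _ y∈
    ... | inj₁ y∈ball = go t (<⇒≤ t<n) y∈ball
    ... | inj₂ y∈new with y∈Z , y∈N ← x∈p∩q⁻ _ _ y∈new with _ , u , u∈ball , uy ← ∈N⁻ y∈N =
      step (ball-mono (<⇒≤ t<n) u∈ball) (go t (<⇒≤ t<n) u∈ball) y∈Z uy

  component⊆ : component Z x ⊆ Z
  component⊆ = component-ind (_∈ _) (λ x∈Z → x∈Z) (λ _ _ v∈Z _ → v∈Z)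

  x∈component : x ∈ Z → x ∈ component Z x
  x∈component {x} x∈Z = ball-mono {t′ = n} z≤n (x∈p∩q⁺ (x∈⁅x⁆ x , x∈Z))

  component-source : y ∈ component Z x → x ∈ Z
  component-source = component-ind (λ _ → _ ∈ _) (λ x∈Z → x∈Z) (λ _ x∈Z _ _ → x∈Z)

  component-trans : y ∈ component Z x → w ∈ component Z y → w ∈ component Z x
  component-trans y∈ = component-ind (_∈ component _ _) (λ _ → y∈) (λ _ u∈ → component-closed u∈)

  component-adj : x ∈ Z → v ∈ Z → Adj G x v → v ∈ component Z x
  component-adj x∈Z = component-closed (x∈component x∈Z)

  component-sym : y ∈ component Z x → x ∈ component Z y
  component-sym = component-ind (λ u → _ ∈ component _ u) x∈component
    λ u∈ x∈ v∈Z uv → component-trans (component-adj v∈Z (component⊆ u∈) (Adj-sym uv)) x∈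

  component-within : component Z x ⊆ Z′ → component Z x ⊆ component Z′ x
  component-within C⊆Z′ = component-ind (_∈ component _ _)
    (λ x∈Z → x∈component (C⊆Z′ (x∈component x∈Z)))
    (λ u∈ u∈′ v∈Z uv → component-closed u∈′ (C⊆Z′ (component-closed u∈ v∈Z uv)) uv)

  component-mono : Z ⊆ Z′ → component Z x ⊆ component Z′ x
  component-mono Z⊆Z′ = component-within (Z⊆Z′ ∘ component⊆)

  component-via-neighbour : y ∈ component Z x → y ≢ x → ∃[ c ] Adj G x c × y ∈ component (Z - x) c
  component-via-neighbour {Z = Z} {x} = component-ind Via (λ _ x≢x → contradiction refl x≢x) extend
    where
    Via : Fin n → Set
    Via y = y ≢ x → ∃[ c ] Adj G x c × y ∈ component (Z - x) c
    extend : ∀ {u v} → u ∈ component Z x → Via u → v ∈ Z → Adj G u v → Via v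
    extend {u} _ via v∈Z uv v≢x with u ≟ x
    ... | yes refl = _ , uv , x∈component (x∈p∧x≢y⇒x∈p-y v∈Z v≢x)
    ... | no u≢x with c , xc , u∈ ← via u≢x =
      c , xc , component-closed u∈ (x∈p∧x≢y⇒x∈p-y v∈Z v≢x) uv

  Connected : Subset n → Set
  Connected T = ∀ {x y} → x ∈ T → y ∈ T → y ∈ component T x

  component-connected : Connected (component Z w)
  component-connected x∈ y∈ =
    component-within (component-trans x∈) (component-trans (component-sym x∈) y∈)

-- Forests

last-∷ʳ : ∀ {A : Set} (y : A) xs z → last (y ∷ xs ∷ʳ z) ≡ just z
last-∷ʳ y []       z = refl
last-∷ʳ y (x ∷ xs) z = last-∷ʳ x xs z

module _ {n : ℕ} (G : Graph n) where

  private
    variable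
      a u v x y : Fin n
      Q Z : Subset n

  open DecMembership (_≟_ {n}) using () renaming (_∈?_ to _∈ˡ?_)

  record SimplePath (Z : Subset n) (y x : Fin n) : Set where
    constructor simple-path
    field
      rest   : List (Fin n)
      unique : Unique (y ∷ rest)
      path   : Path G (y ∷ rest)
      within : All (_∈ Z) (y ∷ rest)
      ends   : last (y ∷ rest) ≡ just x

  simple-path-suffix : ∀ {rest} → v List.∈ y ∷ rest → Unique (y ∷ rest) → Path G (y ∷ rest) →
                       All (_∈ Z) (y ∷ rest) → last (y ∷ rest) ≡ just x → SimplePath Z v x
  simple-path-suffix (here refl) unique path within ends = simple-path _ unique path within ends
  simple-path-suffix {rest = _ ∷ _} (there v∈) (_ ∷ unique) (_ ∷ path) (_ ∷ within) ends =
    simple-path-suffix v∈ unique path within ends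

  component⇒simple-path : y ∈ component G Z x → SimplePath Z y x
  component⇒simple-path {Z = Z} {x} = component-ind G (λ y → SimplePath Z y x) trivial extend
    where
    trivial : x ∈ Z → SimplePath Z x x
    trivial x∈Z = simple-path [] ([] ∷ []) [ x ] (x∈Z ∷ []) refl
    extend : ∀ {u v} → u ∈ component G Z x → SimplePath Z u x → v ∈ Z → Adj G u v → SimplePath Z v x
    extend {u} {v} _ (simple-path rest unique path within ends) v∈Z uv with v ∈ˡ? u ∷ rest
    ... | yes v∈ = simple-path-suffix v∈ unique path within ends
    ... | no v∉  =
      simple-path (u ∷ rest) (¬Any⇒All¬ _ v∉ ∷ unique) (Adj-sym G uv ∷ path) (v∈Z ∷ within) ends

  closed-path⇒cycle : ∀ {rest} → Unique (a ∷ y ∷ rest) → Path G (a ∷ y ∷ rest) →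
                      last (y ∷ rest) ≡ just x → x ≢ y → Adj G x a → Cycle G
  closed-path⇒cycle {a} {y} {rest = rest} unique path ends x≢y xa with initLast rest
  ... | []        = contradiction (sym (just-injective ends)) x≢y
  ... | mid ∷ʳ′ z with refl ← just-injective (trans (sym (last-∷ʳ y mid z)) ends) = record
    { v₀ = a ; v₁ = y ; rest = mid ; last = z ; distinct = unique ; path = path ; closing = xa }

  separated-neighbours : IsForest G → Adj G a x → Adj G a y → x ≢ y → a ∉ Z → y ∉ component G Z x
  separated-neighbours {a} {Z = Z} forest ax ay x≢y a∉Z y∈
    with simple-path rest unique path within ends ← component⇒simple-path y∈ =
    forest (closed-path⇒cycle (All.map (λ w∈Z → a∉Z ∘ λ { refl → w∈Z }) within ∷ unique)
                              (ay ∷ path) ends x≢y (Adj-sym G ax))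

  Pendant : Subset n → Fin n → Fin n → Set
  Pendant Q p q = ∀ {z} → z ∈ Q → Adj G p z → z ≡ q

  pendant-or-neighbour : ∀ Q p q → Pendant Q p q ⊎ ∃[ y ] y ∈ Q × Adj G p y × y ≢ q
  pendant-or-neighbour Q p q with any? (λ y → y ∈? Q ×-dec adj G p y ≟ᵇ true ×-dec ¬? (y ≟ q))
  ... | yes neighbour = inj₂ neighbour
  ... | no ¬neighbour = inj₁ λ {z} z∈Q pz →
    decidable-stable (z ≟ q) λ z≢q → ¬neighbour (z , z∈Q , pz , z≢q)

  module _ (forest : IsForest G) where

    pendant-in-branch : ∀ f → ∣ component G (Q - a) x ∣ ≤ f → x ∈ Q → x ≢ a → Adj G a x →
                        Σ[ p ∈ Fin n ] p ∈ Q × Σ[ q ∈ Fin n ] Pendant Q p q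
    pendant-in-branch {Q} {a} {x} f size x∈Q x≢a ax with pendant-or-neighbour Q x a
    ... | inj₁ pendant = x , x∈Q , a , pendant
    ... | inj₂ (y , y∈Q , xy , y≢a) with f
    ...   | zero   = contradiction size (<⇒≱ (≤-<-trans z≤n (x∈p⇒∣p-x∣<∣p∣ x∈branch)))
      where x∈branch = x∈component G (x∈p∧x≢y⇒x∈p-y x∈Q x≢a)
    ...   | suc f′ =
      pendant-in-branch f′ (≤-pred (≤-trans (p⊂q⇒∣p∣<∣q∣ shrinks) size)) y∈Q (Adj⇒≢ G xy ∘ sym) xy
      where
      next⊆Q-a : component G (Q - x) y ⊆ Q - a
      next⊆Q-a w∈ = x∈p∧x≢y⇒x∈p-y (p─q⊆p Q ⁅ x ⁆ (component⊆ G w∈))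
        λ { refl → separated-neighbours forest xy (Adj-sym G ax) y≢a x∉p-x w∈ }
      y∈branch : y ∈ component G (Q - a) x
      y∈branch = component-adj G (x∈p∧x≢y⇒x∈p-y x∈Q x≢a) (x∈p∧x≢y⇒x∈p-y y∈Q y≢a) xy
      shrinks : component G (Q - x) y ⊂ component G (Q - a) x
      shrinks = (λ w∈ → component-trans G y∈branch (component-within G next⊆Q-a w∈)) ,
                x , x∈component G (x∈p∧x≢y⇒x∈p-y x∈Q x≢a) , x∉p-x ∘ component⊆ G

    pendant-exists : x ∈ Q → Σ[ p ∈ Fin n ] p ∈ Q × Σ[ q ∈ Fin n ] Pendant Q p q
    pendant-exists {x} {Q} x∈Q with pendant-or-neighbour Q x x
    ... | inj₁ pendant = x , x∈Q , x , pendant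
    ... | inj₂ (y , y∈Q , xy , y≢x) = pendant-in-branch n (∣p∣≤n (component G (Q - x) y)) y∈Q y≢x xy

-- Runs of the firefighting game on a region

module _ {n : ℕ} (G : Graph n) where

  private
    variable
      k : ℕ
      p q : Fin n
      R C D D₀ D₁ D′ F H X : Subset n

  SpreadsInto : Subset n → Subset n → Subset n → Set
  SpreadsInto R X Y = ∀ {u v} → u ∈ X → v ∈ R → Adj G u v → v ∈ Y

  -- Fire spreads only along edges inside the region R, and the burning sets are only known up to
  -- inclusion: a run from D to D′ turns every burning set contained in D into one contained in D′.
  record Round (R D F D′ : Subset n) : Set where
    field
      stays   : ∀ {v} → v ∈ R → v ∈ D ─ F → v ∈ D′
      spreads : ∀ {u v} → u ∈ R → v ∈ R → u ∈ D ─ F → Adj G u v → v ∈ D′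

  data Run (R : Subset n) (k : ℕ) : Subset n → Subset n → Set where
    done  : D ⊆ D′ → Run R k D D′
    round : ∀ F → ∣ F ∣ ≤ k → Round R D F D₁ → Run R k D₁ D′ → Run R k D D′

  round-shrink : D₀ ⊆ D → Round R D F D′ → Round R D₀ F D′
  round-shrink D₀⊆D r = record
    { stays   = λ v∈R v∈ → stays v∈R (p⊆q⇒p─r⊆q─r D₀⊆D v∈)
    ; spreads = λ u∈R v∈R u∈ → spreads u∈R v∈R (p⊆q⇒p─r⊆q─r D₀⊆D u∈) }
    where open Round r

  run-from : D₀ ⊆ D → Run R k D D′ → Run R k D₀ D′
  run-from D₀⊆D (done D⊆D′)      = done (D⊆D′ ∘ D₀⊆D)
  run-from D₀⊆D (round F f r rs) = round F f (round-shrink D₀⊆D r) rs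

  run-++ : Run R k D D₁ → Run R k D₁ D′ → Run R k D D′
  run-++ (done D⊆D₁)      rs′ = run-from D⊆D₁ rs′
  run-++ (round F f r rs) rs′ = round F f r (run-++ rs rs′)

  run-to : D₁ ⊆ D′ → Run R k D D₁ → Run R k D D′
  run-to D₁⊆D′ rs = run-++ rs (done D₁⊆D′)

  run-budget : ∀ {j} → j ≤ k → Run R j D D′ → Run R k D D′
  run-budget j≤k (done D⊆D′)      = done D⊆D′
  run-budget j≤k (round F f r rs) = round F (≤-trans f j≤k) r (run-budget j≤k rs)

  lift-round : H ⊆ X → SpreadsInto R C (C ∪ H) → SpreadsInto R (X ─ H) X →
               Round C D F D₁ → Round R ((D ∩ C) ∪ X) (F ∪ H) ((D₁ ∩ C) ∪ X)
  lift-round {H} {X} {R} {C} {D} {F} {D₁} H⊆X C↝ X↝ r =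
    record { stays = stays′ ; spreads = spreads′ }
    where
    open Round r
    split : ∀ {v} → v ∈ ((D ∩ C) ∪ X) ─ (F ∪ H) → (v ∈ C × v ∈ D ─ F) ⊎ v ∈ X ─ H
    split v∈ with x∈p∪q⁻ (D ∩ C) X (p─q⊆p _ _ v∈)
    ... | inj₂ v∈X  = inj₂ (x∈p∧x∉q⇒x∈p─q v∈X (x∈p─q⇒x∉q v∈ ∘ q⊆p∪q F H))
    ... | inj₁ v∈DC with v∈D , v∈C ← x∈p∩q⁻ D C v∈DC =
      inj₁ (v∈C , x∈p∧x∉q⇒x∈p─q v∈D (x∈p─q⇒x∉q v∈ ∘ p⊆p∪q H))
    stays′ : ∀ {v} → v ∈ R → v ∈ ((D ∩ C) ∪ X) ─ (F ∪ H) → v ∈ (D₁ ∩ C) ∪ X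
    stays′ v∈R v∈ with split v∈
    ... | inj₁ (v∈C , v∈D─F) = x∈p∪q⁺ (inj₁ (x∈p∩q⁺ (stays v∈C v∈D─F , v∈C)))
    ... | inj₂ v∈X─H         = x∈p∪q⁺ (inj₂ (p─q⊆p X H v∈X─H))
    spreads′ : ∀ {u v} → u ∈ R → v ∈ R → u ∈ ((D ∩ C) ∪ X) ─ (F ∪ H) → Adj G u v → v ∈ (D₁ ∩ C) ∪ X
    spreads′ u∈R v∈R u∈ uv with split u∈
    ... | inj₂ u∈X─H = x∈p∪q⁺ (inj₂ (X↝ u∈X─H v∈R uv))
    ... | inj₁ (u∈C , u∈D─F) with x∈p∪q⁻ C H (C↝ u∈C v∈R uv)
    ...   | inj₁ v∈C = x∈p∪q⁺ (inj₁ (x∈p∩q⁺ (spreads u∈C v∈C u∈D─F uv , v∈C)))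
    ...   | inj₂ v∈H = x∈p∪q⁺ (inj₂ (H⊆X v∈H))

  lift-run : ∀ {j} → H ⊆ X → SpreadsInto R C (C ∪ H) → SpreadsInto R (X ─ H) X →
             Run C j D D′ → Run R (j + ∣ H ∣) ((D ∩ C) ∪ X) ((D′ ∩ C) ∪ X)
  lift-run H⊆X C↝ X↝ (done D⊆D′)      = done (p⊆q⇒p∪r⊆q∪r (p⊆q⇒p∩r⊆q∩r D⊆D′))
  lift-run {H} H⊆X C↝ X↝ (round F f r rs) =
    round (F ∪ H) (≤-trans (∣p∪q∣≤∣p∣+∣q∣ F H) (+-monoˡ-≤ ∣ H ∣ f))
          (lift-round H⊆X C↝ X↝ r) (lift-run H⊆X C↝ X↝ rs)

  -- While C is cleared, the guards H, defended in every round, keep the rest X of the fire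
  -- out of C.
  guarded-run : ∀ {j} → H ⊆ X → SpreadsInto R C (C ∪ H) → SpreadsInto R (X ─ H) X →
                Run C j C ∅ → Run R (j + ∣ H ∣) (C ∪ X) X
  guarded-run {X = X} {C = C} H⊆X C↝ X↝ rs =
    run-to ∅∩C∪X⊆X (run-from (p⊆q⇒p∪r⊆q∪r λ v∈C → x∈p∩q⁺ (v∈C , v∈C)) (lift-run H⊆X C↝ X↝ rs))
    where
    ∅∩C∪X⊆X : (∅ ∩ C) ∪ X ⊆ X
    ∅∩C∪X⊆X v∈ with x∈p∪q⁻ (∅ ∩ C) X v∈
    ... | inj₁ v∈∅∩C = contradiction (p∩q⊆p ∅ C v∈∅∩C) ∉⊥
    ... | inj₂ v∈X   = v∈X

  isolated-run : ∀ {j} → SpreadsInto R C C → SpreadsInto R X X → Run C j C ∅ → Run R j (C ∪ X) X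
  isolated-run {j = j} C↝ X↝ rs = run-budget (≤-reflexive (trans (cong (j +_) (∣⊥∣≡0 n)) (+-identityʳ j)))
    (guarded-run (λ v∈∅ → contradiction v∈∅ ∉⊥) (λ u∈ v∈R uv → p⊆p∪q ∅ (C↝ u∈ v∈R uv))
                 (λ u∈ → X↝ (p─q⊆p _ ∅ u∈)) rs)

  release : 2 ≤ k → SpreadsInto R (X - p) X → (∀ {v} → v ∈ R → v ∈ X → Adj G p v → v ≡ q) →
            Run R k X (X - p)
  release {k} {R} {X} {p} {q} 2≤k X↝ only-q = round (⁅ p ⁆ ∪ ⁅ q ⁆) budget guard (done λ v∈ → v∈)
    where
    budget : ∣ ⁅ p ⁆ ∪ ⁅ q ⁆ ∣ ≤ k
    budget = ≤-trans (∣p∪q∣≤∣p∣+∣q∣ ⁅ p ⁆ ⁅ q ⁆)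
                     (subst (_≤ k) (sym (cong₂ _+_ (∣⁅x⁆∣≡1 p) (∣⁅x⁆∣≡1 q))) 2≤k)
    undefended : ∀ {v} → v ∈ X ─ (⁅ p ⁆ ∪ ⁅ q ⁆) → v ∈ X × v ≢ p × v ≢ q
    undefended v∈ = p─q⊆p X _ v∈ ,
                    x∉⁅y⁆⇒x≢y (x∈p─q⇒x∉q v∈ ∘ p⊆p∪q ⁅ q ⁆) ,
                    x∉⁅y⁆⇒x≢y (x∈p─q⇒x∉q v∈ ∘ q⊆p∪q ⁅ p ⁆ ⁅ q ⁆)
    guard : Round R X (⁅ p ⁆ ∪ ⁅ q ⁆) (X - p)
    guard = record
      { stays   = λ _ v∈ → let v∈X , v≢p , _ = undefended v∈ in x∈p∧x≢y⇒x∈p-y v∈X v≢p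
      ; spreads = λ u∈R v∈R u∈ uv → let u∈X , u≢p , u≢q = undefended u∈ in
          x∈p∧x≢y⇒x∈p-y (X↝ (x∈p∧x≢y⇒x∈p-y u∈X u≢p) v∈R uv)
                        λ { refl → u≢q (only-q u∈R u∈X (Adj-sym G uv)) } }

  strategy : Run R k D D′ → List (Subset n)
  strategy (done _)         = []
  strategy (round F _ _ rs) = F ∷ strategy rs

  strategy-bounded : (rs : Run R k D D′) → IsStrategy k (strategy rs)
  strategy-bounded (done _)         = []
  strategy-bounded (round _ f _ rs) = f ∷ strategy-bounded rs

  round⇒step⊆ : ∀ {B} → Round ⊤ D F D′ → B ⊆ D → step G B F ⊆ D′
  round⇒step⊆ {F = F} {B = B} r B⊆D v∈ with x∈p∪q⁻ (B ─ F) (N G (B ─ F)) v∈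
  ... | inj₁ v∈B─F = Round.stays r ∈⊤ (p⊆q⇒p─r⊆q─r B⊆D v∈B─F)
  ... | inj₂ v∈N with _ , u , u∈B─F , uv ← ∈N⁻ G v∈N =
    Round.spreads r ∈⊤ ∈⊤ (p⊆q⇒p─r⊆q─r B⊆D u∈B─F) uv

  burning⊆ : ∀ {B} (rs : Run ⊤ k D D′) → B ⊆ D → foldl (step G) B (strategy rs) ⊆ D′
  burning⊆ (done D⊆D′)      B⊆D = D⊆D′ ∘ B⊆D
  burning⊆ (round F _ r rs) B⊆D = burning⊆ rs (round⇒step⊆ r B⊆D)

  run⇒winning : Run ⊤ k ⊤ ∅ → WinningStrategy G k
  run⇒winning rs = strategy rs , strategy-bounded rs , ⊆-antisym (burning⊆ rs λ v∈ → v∈) ⊥⊆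

  run-by-components : (P : ℕ → Set) → (∀ {a b} → a ≤ b → P b → P a) →
                      (∀ {T} → Connected G T → P ∣ T ∣ → Run T k T ∅) →
                      ∀ S → (∀ {w} → w ∈ S → P ∣ component G S w ∣) → Run S k S ∅
  run-by-components {k} P P-down clear-connected S = go n S (∣p∣≤n S)
    where
    go : ∀ f S → ∣ S ∣ ≤ f → (∀ {w} → w ∈ S → P ∣ component G S w ∣) → Run S k S ∅
    go f S size small with nonempty? S
    ... | no empty = done λ v∈ → contradiction (_ , v∈) empty
    ... | yes (w , w∈S) with f
    ...   | zero  = contradiction size (<⇒≱ (≤-<-trans z≤n (x∈p⇒∣p-x∣<∣p∣ w∈S)))
    ...   | suc f = run-++
      (run-from S⊆T∪S′ (isolated-run T-closed S′-closed
        (clear-connected (component-connected G) (small w∈S))))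
      (run-from (p⊆p∪q ∅) (isolated-run S′-closed (λ u∈∅ → contradiction u∈∅ ∉⊥)
        (go f S′ size′ small′)))
      where
      T  = component G S w
      S′ = S ─ T
      T-closed : SpreadsInto S T T
      T-closed = component-closed G
      S′-closed : SpreadsInto S S′ S′
      S′-closed u∈ v∈S uv = x∈p∧x∉q⇒x∈p─q v∈S λ v∈T →
        x∈p─q⇒x∉q u∈ (component-closed G v∈T (p─q⊆p S T u∈) (Adj-sym G uv))
      S⊆T∪S′ : S ⊆ T ∪ S′
      S⊆T∪S′ {v} v∈S with v ∈? T
      ... | yes v∈T = x∈p∪q⁺ (inj₁ v∈T)
      ... | no v∉T  = x∈p∪q⁺ (inj₂ (x∈p∧x∉q⇒x∈p─q v∈S v∉T))
      size′ : ∣ S′ ∣ ≤ f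
      size′ = ≤-pred (≤-trans (p∩q≢∅⇒∣p─q∣<∣p∣ S T (w , x∈p∩q⁺ (w∈S , x∈component G w∈S))) size)
      small′ : ∀ {v} → v ∈ S′ → P ∣ component G S′ v ∣
      small′ v∈ = P-down (p⊆q⇒∣p∣≤∣q∣ (component-mono G (p─q⊆p S T))) (small (p─q⊆p S T v∈))

-- The spine of a tree

3b<s∧3c<s⇒b+c<s : ∀ {s} b c → 3 * b < s → 3 * c < s → b + c < s
3b<s∧3c<s⇒b+c<s {s} b c 3b<s 3c<s = *-cancelˡ-< 3 (b + c) s (begin-strict
  3 * (b + c)    ≡⟨ *-distribˡ-+ 3 b c ⟩
  3 * b + 3 * c  <⟨ +-mono-< 3b<s 3c<s ⟩
  s + s          ≤⟨ +-monoʳ-≤ s (m≤m+n s (s + 0)) ⟩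
  3 * s          ∎)
  where open ≤-Reasoning

s≤3a∧s≤3b∧s≤3c⇒s≤a+b+c : ∀ {s} a b c → s ≤ 3 * a → s ≤ 3 * b → s ≤ 3 * c → s ≤ a + b + c
s≤3a∧s≤3b∧s≤3c⇒s≤a+b+c {s} a b c s≤3a s≤3b s≤3c = *-cancelˡ-≤ 3 (begin
  3 * s                    ≡⟨ thrice s ⟩
  s + s + s                ≤⟨ +-mono-≤ (+-mono-≤ s≤3a s≤3b) s≤3c ⟩
  3 * a + 3 * b + 3 * c    ≡⟨ distrib a b c ⟩
  3 * (a + b + c)          ∎)
  where
  open ≤-Reasoning
  thrice : ∀ s → 3 * s ≡ s + s + s
  thrice = solve-∀
  distrib : ∀ a b c → 3 * a + 3 * b + 3 * c ≡ 3 * (a + b + c)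
  distrib = solve-∀

3c<s∧2s+1<3^[1+j]⇒2c+1<3^j : ∀ {s} c j → 3 * c < s → 2 * s + 1 < 3 ^ suc j → 2 * c + 1 < 3 ^ j
3c<s∧2s+1<3^[1+j]⇒2c+1<3^j {s} c j 3c<s 2s+1<3^[1+j] =
  *-cancelˡ-< 3 (2 * c + 1) (3 ^ j) (begin-strict
    3 * (2 * c + 1)      ≡⟨ regroup c ⟩
    2 * (1 + 3 * c) + 1  ≤⟨ +-monoˡ-≤ 1 (*-monoʳ-≤ 2 3c<s) ⟩
    2 * s + 1            <⟨ 2s+1<3^[1+j] ⟩
    3 ^ suc j            ∎)
  where
  open ≤-Reasoning
  regroup : ∀ c → 3 * (2 * c + 1) ≡ 2 * (1 + 3 * c) + 1
  regroup = solve-∀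

module Spine {n : ℕ} {G : Graph n} (forest : IsForest G) (T : Subset n) (T-connected : Connected G T)
  where

  private
    variable
      a p q u u₁ u₂ u₃ v w x y z : Fin n
      A : Subset n

  s : ℕ
  s = ∣ T ∣

  branch : Fin n → Fin n → Subset n
  branch x a = component G (T - x) a

  branch⊆T : branch x a ⊆ T
  branch⊆T = p─q⊆p T _ ∘ component⊆ G

  x∉branch : x ∉ branch x a
  x∉branch = x∉p-x ∘ component⊆ G

  a∈branch : a ∈ T → a ≢ x → a ∈ branch x a
  a∈branch a∈T a≢x = x∈component G (x∈p∧x≢y⇒x∈p-y a∈T a≢x)

  branches-cover : x ∈ T → y ∈ T → x ≢ y → z ∈ T → z ∈ branch x y ⊎ z ∈ branch y x
  branches-cover {x} {y} {z} x∈T y∈T x≢y z∈T with z ≟ x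
  ... | yes refl = inj₂ (a∈branch x∈T x≢y)
  ... | no z≢x with component-via-neighbour G (T-connected x∈T z∈T) z≢x
  ... | c , xc , z∈ with y ∈? branch x c
  ...   | yes y∈ = inj₁ (component-trans G (component-sym G y∈) z∈)
  ...   | no y∉  = inj₂ (component-trans G c∈ (component-within G avoids-y z∈))
    where
    avoids-y : branch x c ⊆ T - y
    avoids-y w∈ = x∈p∧x≢y⇒x∈p-y (branch⊆T w∈) λ { refl → y∉ w∈ }
    c∈ : c ∈ branch y x
    c∈ = component-adj G (x∈p∧x≢y⇒x∈p-y x∈T x≢y)
                         (avoids-y (x∈component G (component-source G z∈))) xc

  branch-away : x ∈ T → a ∈ T → a ≢ x → y ∈ T → y ≢ x → y ∉ branch x a →
                a ∈ branch y x × branch x a ⊆ branch y a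
  branch-away {x} {a} {y} x∈T a∈T a≢x y∈T y≢x y∉ with branches-cover x∈T y∈T (y≢x ∘ sym) a∈T
  ... | inj₁ a∈ = contradiction (component-sym G a∈) y∉
  ... | inj₂ a∈ = a∈ , component-within G (λ w∈ → x∈p∧x≢y⇒x∈p-y (branch⊆T w∈) λ { refl → y∉ w∈ })

  Heavy : Fin n → Set
  Heavy v = v ∈ T × (∀ x → x ∈ T → x ≢ v → s ≤ 3 * ∣ branch x v ∣)

  heavy? : ∀ v → Dec (Heavy v)
  heavy? v = v ∈? T ×-dec all? λ x → x ∈? T →-dec ¬? (x ≟ v) →-dec s ≤? 3 * ∣ branch x v ∣

  spine : Subset n
  spine = select heavy?

  spine⊆T : spine ⊆ T
  spine⊆T = proj₁ ∘ ∈-select⁻ heavy?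

  spine-heavy : v ∈ spine → x ∈ T → x ≢ v → s ≤ 3 * ∣ branch x v ∣
  spine-heavy {x = x} v∈ = proj₂ (∈-select⁻ heavy? v∈) x

  off-spine : Subset n
  off-spine = T ─ spine

  off-spine⊆T-x : x ∈ spine → off-spine ⊆ T - x
  off-spine⊆T-x x∈ v∈ = x∈p∧x≢y⇒x∈p-y (p─q⊆p T spine v∈) λ { refl → x∈p─q⇒x∉q v∈ x∈ }

  LightFor : Fin n → Fin n → Set
  LightFor a x = x ∈ T × x ≢ a × 3 * ∣ branch x a ∣ < s

  light-for? : ∀ a x → Dec (LightFor a x)
  light-for? a x = x ∈? T ×-dec ¬? (x ≟ a) ×-dec 3 * ∣ branch x a ∣ <? s

  heavy-or-light : a ∈ T → a ∈ spine ⊎ ∃ (LightFor a)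
  heavy-or-light {a} a∈T with any? (light-for? a)
  ... | yes light = inj₂ light
  ... | no ¬light =
    inj₁ (∈-select⁺ heavy? (a∈T , λ x x∈T x≢a → ≮⇒≥ λ lt → ¬light (x , x∈T , x≢a , lt)))

  -- A light branch at y containing x would either cover T together with the branch at x containing
  -- a, or strictly contain that branch.
  heaviest-light-is-heavy : a ∈ T → LightFor a x →
                            (∀ {y} → LightFor a y → ∣ branch y a ∣ ≤ ∣ branch x a ∣) → x ∈ spine
  heaviest-light-is-heavy {a} {x} a∈T (x∈T , x≢a , light) heaviest = ∈-select⁺ heavy? (x∈T , heavy)
    where
    heavy : ∀ y → y ∈ T → y ≢ x → s ≤ 3 * ∣ branch y x ∣
    heavy y y∈T y≢x with s ≤? 3 * ∣ branch y x ∣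
    ... | yes h = h
    ... | no ¬h with y ∈? branch x a
    ...   | yes y∈ = contradiction
      (≤-trans (p⊆q⇒∣p∣≤∣q∣ cover) (∣p∪q∣≤∣p∣+∣q∣ (branch x a) (branch y x)))
      (<⇒≱ (3b<s∧3c<s⇒b+c<s (∣ branch x a ∣) (∣ branch y x ∣) light (≰⇒> ¬h)))
      where
      cover : T ⊆ branch x a ∪ branch y x
      cover z∈T with branches-cover x∈T y∈T (y≢x ∘ sym) z∈T
      ... | inj₁ z∈ = x∈p∪q⁺ (inj₁ (component-trans G y∈ z∈))
      ... | inj₂ z∈ = x∈p∪q⁺ (inj₂ z∈)
    ...   | no y∉ = contradiction (heaviest (y∈T , y≢a , light-y)) (<⇒≱ grows)
      where
      away = branch-away x∈T a∈T (x≢a ∘ sym) y∈T y≢x y∉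
      y≢a : y ≢ a
      y≢a refl = y∉ (a∈branch a∈T (x≢a ∘ sym))
      light-y : 3 * ∣ branch y a ∣ < s
      light-y = ≤-<-trans (*-monoʳ-≤ 3 (p⊆q⇒∣p∣≤∣q∣ (component-trans G (proj₁ away)))) (≰⇒> ¬h)
      grows : ∣ branch x a ∣ < ∣ branch y a ∣
      grows = p⊂q⇒∣p∣<∣q∣ (proj₂ away , x , component-sym G (proj₁ away) , x∉branch)

  light-branch-at-spine : a ∈ off-spine → Σ[ x ∈ Fin n ] x ∈ spine × LightFor a x
  light-branch-at-spine {a} a∈off with heavy-or-light (p─q⊆p T spine a∈off)
  ... | inj₁ a∈spine = contradiction a∈spine (x∈p─q⇒x∉q a∈off)
  ... | inj₂ (_ , light₀)
    with x , x∈ , heaviest ← argmax-in (select (light-for? a)) (λ x → ∣ branch x a ∣)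
                                       (∈-select⁺ (light-for? a) light₀) =
    x , heaviest-light-is-heavy a∈T light (heaviest ∘ ∈-select⁺ (light-for? a)) , light
    where
    a∈T = p─q⊆p T spine a∈off
    light = ∈-select⁻ (light-for? a) x∈

  branches-disjoint : Adj G v u₁ → Adj G v u₂ → u₁ ≢ u₂ → w ∈ branch v u₁ → w ∉ branch v u₂
  branches-disjoint vu₁ vu₂ u₁≢u₂ w∈₁ w∈₂ =
    separated-neighbours G forest vu₁ vu₂ u₁≢u₂ x∉p-x (component-trans G w∈₁ (component-sym G w∈₂))

  spine-degree≤2 : v ∈ spine → u₁ ∈ spine → u₂ ∈ spine → u₃ ∈ spine →
                   Adj G v u₁ → Adj G v u₂ → Adj G v u₃ → u₁ ≢ u₂ → u₁ ≢ u₃ → u₂ ≢ u₃ → ⊥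
  spine-degree≤2 {v} {u₁} {u₂} {u₃} v∈ u₁∈ u₂∈ u₃∈ vu₁ vu₂ vu₃ u₁≢u₂ u₁≢u₃ u₂≢u₃ =
    <⇒≱ (begin-strict
      ∣ B₁ ∣ + ∣ B₂ ∣ + ∣ B₃ ∣  ≡⟨ sym sizes ⟩
      ∣ (B₁ ∪ B₂) ∪ B₃ ∣         ≤⟨ p⊆q⇒∣p∣≤∣q∣ union⊆T-v ⟩
      ∣ T - v ∣                  <⟨ x∈p⇒∣p-x∣<∣p∣ (spine⊆T v∈) ⟩
      s                          ∎)
    (s≤3a∧s≤3b∧s≤3c⇒s≤a+b+c (∣ B₁ ∣) (∣ B₂ ∣) (∣ B₃ ∣)
                            (heavy u₁∈ vu₁) (heavy u₂∈ vu₂) (heavy u₃∈ vu₃))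
    where
    open ≤-Reasoning
    B₁ = branch v u₁
    B₂ = branch v u₂
    B₃ = branch v u₃
    heavy : u ∈ spine → Adj G v u → s ≤ 3 * ∣ branch v u ∣
    heavy u∈ vu = spine-heavy u∈ (spine⊆T v∈) (Adj⇒≢ G vu)
    B₁∪B₂∌ : ∀ {w} → w ∈ B₁ ∪ B₂ → w ∉ B₃
    B₁∪B₂∌ w∈ with x∈p∪q⁻ B₁ B₂ w∈
    ... | inj₁ w∈₁ = branches-disjoint vu₁ vu₃ u₁≢u₃ w∈₁
    ... | inj₂ w∈₂ = branches-disjoint vu₂ vu₃ u₂≢u₃ w∈₂
    sizes : ∣ (B₁ ∪ B₂) ∪ B₃ ∣ ≡ ∣ B₁ ∣ + ∣ B₂ ∣ + ∣ B₃ ∣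
    sizes = trans (∣p∪q∣≡∣p∣+∣q∣ (B₁ ∪ B₂) B₃ B₁∪B₂∌)
                  (cong (_+ ∣ B₃ ∣) (∣p∪q∣≡∣p∣+∣q∣ B₁ B₂ (branches-disjoint vu₁ vu₂ u₁≢u₂)))
    union⊆T-v : (B₁ ∪ B₂) ∪ B₃ ⊆ T - v
    union⊆T-v w∈ with x∈p∪q⁻ (B₁ ∪ B₂) B₃ w∈
    ... | inj₂ w∈₃ = component⊆ G w∈₃
    ... | inj₁ w∈₁₂ with x∈p∪q⁻ B₁ B₂ w∈₁₂
    ...   | inj₁ w∈₁ = component⊆ G w∈₁
    ...   | inj₂ w∈₂ = component⊆ G w∈₂

  spine-pendant : q ∈ spine → p ∈ spine → Adj G q p → A ⊆ spine → p ∉ A →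
                  Σ[ r ∈ Fin n ] Pendant G A q r
  spine-pendant {q} {p} {A} q∈ p∈ qp A⊆spine p∉A with pendant-or-neighbour G A q q
  ... | inj₁ pendant          = q , pendant
  ... | inj₂ (r , r∈A , qr , _) = r , λ {z} z∈A qz → decidable-stable (z ≟ r) λ z≢r →
    spine-degree≤2 q∈ p∈ (A⊆spine r∈A) (A⊆spine z∈A) qp qr qz
      (λ { refl → p∉A r∈A }) (λ { refl → p∉A z∈A }) (z≢r ∘ sym)

  heavy∉light-branch : x ∈ spine → 3 * ∣ branch x w ∣ < s → z ∈ spine → z ≢ x → z ∉ branch x w
  heavy∉light-branch x∈ light z∈ z≢x z∈branch =
    <⇒≱ light (≤-trans (spine-heavy z∈ (spine⊆T x∈) (z≢x ∘ sym))
                       (*-monoʳ-≤ 3 (p⊆q⇒∣p∣≤∣q∣ (component-trans G z∈branch))))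

  hanging⊆off-spine : w ∈ component G (off-spine ∪ ⁅ p ⁆) p → w ≢ p → w ∈ off-spine
  hanging⊆off-spine {p = p} w∈ w≢p with x∈p∪q⁻ off-spine ⁅ p ⁆ (component⊆ G w∈)
  ... | inj₁ w∈off = w∈off
  ... | inj₂ w∈⁅p⁆ = contradiction (x∈⁅y⁆⇒x≡y p w∈⁅p⁆) w≢p

  spine-attachment : p ∈ spine → w ∈ component G (off-spine ∪ ⁅ p ⁆) p → w ≢ p →
                     y ∈ spine → Adj G w y → y ≡ p
  spine-attachment {p} {w} {y} p∈ w∈ w≢p y∈ wy
    with x , x∈ , _ , x≢w , light ← light-branch-at-spine (hanging⊆off-spine w∈ w≢p)
    = trans (attached-at-x y∈ y∈branch) (sym (attached-at-x p∈ p∈branch))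
    where
    w∈T = p─q⊆p T spine (hanging⊆off-spine w∈ w≢p)
    attached-at-x : z ∈ spine → (z ≢ x → z ∈ branch x w) → z ≡ x
    attached-at-x z∈ z∈branch =
      decidable-stable (_ ≟ x) λ z≢x → heavy∉light-branch x∈ light z∈ z≢x (z∈branch z≢x)
    y∈branch : y ≢ x → y ∈ branch x w
    y∈branch y≢x = component-closed G (a∈branch w∈T (x≢w ∘ sym)) (x∈p∧x≢y⇒x∈p-y (spine⊆T y∈) y≢x) wy
    p∈branch : p ≢ x → p ∈ branch x w
    p∈branch p≢x = component-sym G (component-within G avoids-x w∈)
      where
      avoids-x : component G (off-spine ∪ ⁅ p ⁆) p ⊆ T - x
      avoids-x v∈ with x∈p∪q⁻ off-spine ⁅ p ⁆ (component⊆ G v∈)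
      ... | inj₁ v∈off = off-spine⊆T-x x∈ v∈off
      ... | inj₂ v∈⁅p⁆ rewrite x∈⁅y⁆⇒x≡y p v∈⁅p⁆ = x∈p∧x≢y⇒x∈p-y (spine⊆T p∈) p≢x

  off-spine-light : w ∈ off-spine →
                    Σ[ x ∈ Fin n ] component G off-spine w ⊆ branch x w × 3 * ∣ branch x w ∣ < s
  off-spine-light w∈ with x , x∈ , _ , _ , light ← light-branch-at-spine w∈ =
    x , component-mono G (off-spine⊆T-x x∈) , light

-- Sweeping a tree along its spine

module _ {n : ℕ} (G : Graph n) where

  ComponentsBelow : ℕ → Subset n → Set
  ComponentsBelow j S = ∀ {w} → w ∈ S → 2 * ∣ component G S w ∣ + 1 < 3 ^ j

  Clears : ℕ → Set
  Clears j = ∀ S → ComponentsBelow j S → Run G S (suc j) S ∅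

module Sweep {n : ℕ} {G : Graph n} (forest : IsForest G) (T : Subset n) (T-connected : Connected G T)
             (j : ℕ) (clear : Clears G j) (T-small : 2 * ∣ T ∣ + 1 < 3 ^ suc j)
  where

  open Spine forest T T-connected

  private
    variable
      u v : Fin n
      X : Subset n

  k : ℕ
  k = suc (suc j)

  pieces-small : ∀ {C} → C ⊆ off-spine → ComponentsBelow G j C
  pieces-small {C} C⊆off {w} w∈ with x , within , light ← off-spine-light (C⊆off w∈) =
    3c<s∧2s+1<3^[1+j]⇒2c+1<3^j (∣ component G C w ∣) j
      (≤-<-trans (*-monoʳ-≤ 3 (p⊆q⇒∣p∣≤∣q∣ (within ∘ component-mono G C⊆off))) light) T-small

  clear-off-spine : X ⊆ off-spine → SpreadsInto G T X X → Run G T k X ∅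
  clear-off-spine {X} X⊆off X↝ = run-budget G (n≤1+n (suc j)) (run-from G (p⊆p∪q ∅)
    (isolated-run G X↝ (λ u∈∅ → contradiction u∈∅ ∉⊥) (clear X (pieces-small X⊆off))))

  record Opening (X : Subset n) : Set where
    field
      {p q}   : Fin n
      p∈X     : p ∈ X
      p∈spine : p ∈ spine
      pendant : Pendant G (X ∩ spine) p q
      spreads : SpreadsInto G T (X - p) X

  Frontier : Subset n → Set
  Frontier X = SpreadsInto G T X X ⊎ Opening X

  find-opening : X ⊆ T → Frontier X → (X ⊆ off-spine × SpreadsInto G T X X) ⊎ Opening X
  find-opening X⊆T (inj₂ opening) = inj₂ opening
  find-opening {X} X⊆T (inj₁ X↝) with nonempty? (X ∩ spine)
  ... | no empty =
    inj₁ ((λ v∈X → x∈p∧x∉q⇒x∈p─q (X⊆T v∈X) λ v∈spine → empty (_ , x∈p∩q⁺ (v∈X , v∈spine))) , X↝)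
  ... | yes (_ , v∈) with p , p∈ , q , pendant ← pendant-exists G forest v∈ = inj₂ record
    { p∈X = proj₁ (x∈p∩q⁻ X spine p∈) ; p∈spine = proj₂ (x∈p∩q⁻ X spine p∈)
    ; pendant = pendant ; spreads = X↝ ∘ p─q⊆p X ⁅ p ⁆ }

  module Burn {X : Subset n} (X⊆T : X ⊆ T) (opening : Opening X) where

    open Opening opening

    hanging : Subset n
    hanging = component G (off-spine ∪ ⁅ p ⁆) p - p

    C X₁ X₂ : Subset n
    C = hanging ∩ X
    X₁ = X ─ C
    X₂ = X₁ - p

    ∈hanging : v ∈ T → v ∉ spine → v ≢ p →
               ∀ {u} → u ∈ component G (off-spine ∪ ⁅ p ⁆) p → Adj G u v → v ∈ hanging
    ∈hanging v∈T v∉spine v≢p u∈ uv =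
      x∈p∧x≢y⇒x∈p-y (component-closed G u∈ (x∈p∪q⁺ (inj₁ (x∈p∧x∉q⇒x∈p─q v∈T v∉spine))) uv) v≢p

    p∈component : p ∈ component G (off-spine ∪ ⁅ p ⁆) p
    p∈component = x∈component G (x∈p∪q⁺ (inj₂ (x∈⁅x⁆ p)))

    C⊆off-spine : C ⊆ off-spine
    C⊆off-spine v∈ with v∈hanging , _ ← x∈p∩q⁻ hanging X v∈ =
      hanging⊆off-spine (p─q⊆p _ _ v∈hanging) (x∈p-y⇒x≢y v∈hanging)

    C-boundary : SpreadsInto G T C (C ∪ ⁅ p ⁆)
    C-boundary {w} {v} w∈C v∈T wv with w∈hanging , w∈X ← x∈p∩q⁻ hanging X w∈C with v ≟ p
    ... | yes refl = x∈p∪q⁺ (inj₂ (x∈⁅x⁆ p))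
    ... | no v≢p with v ∈? spine
    ...   | yes v∈spine = contradiction
      (spine-attachment p∈spine (p─q⊆p _ _ w∈hanging) (x∈p-y⇒x≢y w∈hanging) v∈spine wv) v≢p
    ...   | no v∉spine = x∈p∪q⁺ (inj₁ (x∈p∩q⁺
      (∈hanging v∈T v∉spine v≢p (p─q⊆p _ _ w∈hanging) wv ,
       spreads (x∈p∧x≢y⇒x∈p-y w∈X (x∈p-y⇒x≢y w∈hanging)) v∈T wv)))

    X₁-spreads : SpreadsInto G T (X₁ - p) X₁
    X₁-spreads {u} u∈ v∈T uv with u∈X₁ ← p─q⊆p X₁ ⁅ p ⁆ u∈ = x∈p∧x∉q⇒x∈p─q
      (spreads (x∈p∧x≢y⇒x∈p-y (p─q⊆p X C u∈X₁) (x∈p-y⇒x≢y u∈)) v∈T uv)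
      λ v∈C → [ x∈p─q⇒x∉q u∈X₁ , x∈p-y⇒x≢y u∈ ∘ x∈⁅y⁆⇒x≡y p ]′
                 (x∈p∪q⁻ C ⁅ p ⁆ (C-boundary v∈C (X⊆T (p─q⊆p X C u∈X₁)) (Adj-sym G uv)))

    clear-hanging : Run G T k X X₁
    clear-hanging = run-from G X⊆C∪X₁ (run-budget G budget
      (guarded-run G ⁅p⁆⊆X₁ C-boundary X₁-spreads (clear C (pieces-small C⊆off-spine))))
      where
      X⊆C∪X₁ : X ⊆ C ∪ X₁
      X⊆C∪X₁ {v} v∈X with v ∈? C
      ... | yes v∈C = x∈p∪q⁺ (inj₁ v∈C)
      ... | no v∉C  = x∈p∪q⁺ (inj₂ (x∈p∧x∉q⇒x∈p─q v∈X v∉C))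
      ⁅p⁆⊆X₁ : ⁅ p ⁆ ⊆ X₁
      ⁅p⁆⊆X₁ v∈ rewrite x∈⁅y⁆⇒x≡y p v∈ =
        x∈p∧x∉q⇒x∈p─q p∈X λ p∈C → x∈p-y⇒x≢y (proj₁ (x∈p∩q⁻ hanging X p∈C)) refl
      budget : suc j + ∣ ⁅ p ⁆ ∣ ≤ k
      budget = ≤-reflexive (trans (cong (suc j +_) (∣⁅x⁆∣≡1 p)) (+-comm (suc j) 1))

    p-neighbour : v ∈ T → v ∈ X₁ → Adj G p v → v ≡ q × v ∈ spine
    p-neighbour {v} v∈T v∈X₁ pv with v ∈? spine
    ... | yes v∈spine = pendant (x∈p∩q⁺ (p─q⊆p X C v∈X₁ , v∈spine)) pv , v∈spine
    ... | no v∉spine  = contradiction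
      (x∈p∩q⁺ (∈hanging v∈T v∉spine (Adj⇒≢ G pv ∘ sym) p∈component pv , p─q⊆p X C v∈X₁))
      (x∈p─q⇒x∉q v∈X₁)

    release-p : Run G T k X₁ X₂
    release-p = release G (s≤s (s≤s z≤n)) X₁-spreads λ v∈T v∈X₁ pv → proj₁ (p-neighbour v∈T v∈X₁ pv)

    X₂⊆X : X₂ ⊆ X
    X₂⊆X = p─q⊆p X C ∘ p─q⊆p X₁ ⁅ p ⁆

    X₂-spreads : u ∈ X₂ → v ∈ T → Adj G u v → v ∈ X₂ ⊎ (u ≡ q × v ≡ p)
    X₂-spreads {u} {v} u∈ v∈T uv with v ≟ p
    ... | no v≢p   = inj₁ (x∈p∧x≢y⇒x∈p-y (X₁-spreads u∈ v∈T uv) v≢p)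
    ... | yes refl =
      inj₂ (proj₁ (p-neighbour (X⊆T (X₂⊆X u∈)) (p─q⊆p X₁ ⁅ p ⁆ u∈) (Adj-sym G uv)) , refl)

    fewer : ∣ X₂ ∩ spine ∣ < ∣ X ∩ spine ∣
    fewer = ≤-<-trans (p⊆q⇒∣p∣≤∣q∣ X₂∩spine⊆) (x∈p⇒∣p-x∣<∣p∣ (x∈p∩q⁺ (p∈X , p∈spine)))
      where
      X₂∩spine⊆ : X₂ ∩ spine ⊆ (X ∩ spine) - p
      X₂∩spine⊆ v∈ with v∈X₂ , v∈spine ← x∈p∩q⁻ X₂ spine v∈ =
        x∈p∧x≢y⇒x∈p-y (x∈p∩q⁺ (X₂⊆X v∈X₂ , v∈spine)) (x∈p-y⇒x≢y v∈X₂)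

    next-frontier : Frontier X₂
    next-frontier with q ∈? X₂ ×-dec adj G p q ≟ᵇ true
    ... | yes (q∈X₂ , pq) = inj₂ record
      { p∈X     = q∈X₂
      ; p∈spine = q∈spine
      ; pendant = proj₂ (spine-pendant q∈spine p∈spine (Adj-sym G pq) (p∩q⊆q X₂ spine)
                                       (λ p∈ → x∈p-y⇒x≢y (p∩q⊆p X₂ spine p∈) refl))
      ; spreads = λ u∈ v∈T uv →
          [ (λ v∈X₂ → v∈X₂) , (λ (u≡q , _) → contradiction u≡q (x∈p-y⇒x≢y u∈)) ]′
          (X₂-spreads (p─q⊆p X₂ ⁅ q ⁆ u∈) v∈T uv) }
      where
      q∈spine = proj₂ (p-neighbour (X⊆T (X₂⊆X q∈X₂)) (p─q⊆p X₁ ⁅ p ⁆ q∈X₂) pq)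
    ... | no ¬q∈X₂×pq = inj₁ λ u∈ v∈T uv →
      [ (λ v∈X₂ → v∈X₂) , (λ { (refl , refl) → contradiction (u∈ , Adj-sym G uv) ¬q∈X₂×pq }) ]′
      (X₂-spreads u∈ v∈T uv)

  sweep : ∀ f → ∣ X ∩ spine ∣ ≤ f → X ⊆ T → Frontier X → Run G T k X ∅
  sweep f       bound X⊆T frontier with find-opening X⊆T frontier
  sweep f       bound X⊆T frontier | inj₁ (X⊆off , X↝) = clear-off-spine X⊆off X↝
  sweep zero    bound X⊆T frontier | inj₂ opening =
    contradiction (≤-trans (Burn.fewer X⊆T opening) bound) λ ()
  sweep (suc f) bound X⊆T frontier | inj₂ opening = run-++ G (run-++ G clear-hanging release-p)
    (sweep f (≤-pred (≤-trans fewer bound)) (X⊆T ∘ X₂⊆X) next-frontier)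
    where open Burn X⊆T opening

  clear-tree : Run G T k T ∅
  clear-tree = sweep n (∣p∣≤n (T ∩ spine)) (λ v∈ → v∈) (inj₁ λ _ v∈T _ → v∈T)

-- Clearing a forest

clears : ∀ {n} {G : Graph n} → IsForest G → ∀ j → Clears G j
clears forest zero    S small = done λ w∈ → contradiction (m≤n+m 1 _) (<⇒≱ (small w∈))
clears forest (suc j) = run-by-components _ (λ c → 2 * c + 1 < 3 ^ suc j)
  (λ a≤b → ≤-<-trans (+-monoˡ-≤ 1 (*-monoʳ-≤ 2 a≤b)))
  (λ {T} T-connected T-small → Sweep.clear-tree forest T T-connected j (clears forest j) T-small)

winning-if-small : ∀ {n} {G : Graph n} → IsForest G → ∀ j → 2 * n + 1 < 3 ^ j →
                   WinningStrategy G (suc j)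
winning-if-small {G = G} forest j small = run⇒winning G (clears forest j ⊤ λ {w} _ →
  ≤-<-trans (+-monoˡ-≤ 1 (*-monoʳ-≤ 2 (∣p∣≤n (component G ⊤ w)))) small)

proposition4 : ∀ (n : ℕ) (F : Graph n) → IsForest F → ∀ (m : ℕ) → IsFfn F m →
                 3 ^ (m ∸ 2) ≤ 2 * n + 1
proposition4 n F forest zero          (() , _)
proposition4 n F forest (suc zero)    _                 = m≤n+m 1 (2 * n)
proposition4 n F forest (suc (suc j)) (_ , _ , minimal) =
  ≮⇒≥ λ small → minimal (suc j) (s≤s z≤n) ≤-refl (winning-if-small forest j small)
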